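{- Let $q$ be a prime power, $E=\mathbb{F}_q^n$, and let $\mathcal{M}_1,\mathcal{M}_2$ be two $q$-matroids on $E$. Assume $\mathcal{M}_1$ is full and $\mathcal{M}_2$ has no loops. Then for any $\lambda_1,\lambda_2>0$ with $\lambda_1+\lambda_2=1$, the $q$-polymatroid $\lambda_1\mathcal{M}_1+\lambda_2\mathcal{M}_2$ is full.
   Context: A $q$-matroid is $(\mathcal{L}(E),\rho)$ with $\rho$ integer-valued, $0\le\rho(A)\le\dim A$, monotone and submodular; a loop is a one-dimensional $x$ with $\rho(x)=0$. $\lambda_1\mathcal{M}_1+\lambda_2\mathcal{M}_2$ has rank function $\lambda_1\rho_1+\lambda_2\rho_2$. A $q$-polymatroid is full if $\langle 0\rangle$ is a flat and $E$ is cyclic. $X$ is a flat if $\rho(X)<\rho(X+v)$ for every one-dimensional $v\not\le X$; $X$ is cyclic if for every codimension-one subspace $H$ of $X$ either $\rho(X)=\rho(H)$, or $0<\rho(X)-\rho(H)$ and there is a one-dimensional $a\le X$, $a\not\le H$, with $\rho(X)-\rho(H)<\rho(a)$.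
   Formalization: The weights λ₁ and λ₂ range over the positive rationals rather than the positive reals. -}

module Defs where

open import Level using (0ℓ)
open import Data.Nat as ℕ using (ℕ; zero; suc)
open import Data.Fin using (Fin)
open import Data.Vec using (Vec; []; _∷_; lookup; replicate; zipWith; map)
open import Data.List using (List)
open import Data.List.Membership.Propositional using (_∈_)
open import Data.Product using (Σ; ∃; _×_; _,_; proj₁; proj₂)
open import Data.Sum using (_⊎_)
open import Data.Unit using (⊤; tt)
open import Data.Empty using (⊥)
open import Relation.Nullary using (¬_)
open import Relation.Binary.PropositionalEquality
open import Algebra.Structures using (IsCommutativeRing)
import Data.Integer as ℤ
open import Data.Rational as ℚ using (ℚ)

-- A finite field (every finite field is F_q for a prime power q).

record FiniteField : Set₁ where
  infixl 7 _*_
  infixl 6 _+_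
  field
    Carrier : Set
    _+_ _*_ : Carrier → Carrier → Carrier
    -_      : Carrier → Carrier
    0# 1#   : Carrier
    isCommutativeRing : IsCommutativeRing _≡_ _+_ _*_ -_ 0# 1#
    0≢1     : 0# ≢ 1#
    inverse : ∀ x → x ≢ 0# → Σ Carrier λ y → x * y ≡ 1#
    elements : List Carrier
    complete : ∀ x → x ∈ elements

module Space (F : FiniteField) (n : ℕ) where
  open FiniteField F renaming (Carrier to K)
  open IsCommutativeRing isCommutativeRing
    using (+-assoc; +-comm; +-identityʳ; zeroʳ; distribˡ)

  V : Set
  V = Vec K n

  0v : ∀ {m} → Vec K m
  0v = replicate _ 0#

  infixl 6 _+v_
  infixr 7 _·v_
  _+v_ : ∀ {m} → Vec K m → Vec K m → Vec K m
  _+v_ = zipWith _+_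

  _·v_ : ∀ {m} → K → Vec K m → Vec K m
  c ·v v = map (c *_) v

  private
    +v-0 : ∀ {m} → 0v {m} ≡ 0v +v 0v
    +v-0 {zero} = refl
    +v-0 {suc m} = cong₂ _∷_ (sym (+-identityʳ 0#)) (+v-0 {m})

    ·v-0 : ∀ {m} c → c ·v 0v {m} ≡ 0v
    ·v-0 {zero} c = refl
    ·v-0 {suc m} c = cong₂ _∷_ (zeroʳ c) (·v-0 {m} c)

    +v-interchange : ∀ {m} (a b a' b' : Vec K m) →
      (a +v b) +v (a' +v b') ≡ (a +v a') +v (b +v b')
    +v-interchange [] [] [] [] = refl
    +v-interchange (a ∷ as) (b ∷ bs) (a' ∷ as') (b' ∷ bs') =
      cong₂ _∷_ eq (+v-interchange as bs as' bs')
      where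
        eq : (a + b) + (a' + b') ≡ (a + a') + (b + b')
        eq = begin
          (a + b) + (a' + b') ≡⟨ +-assoc a b (a' + b') ⟩
          a + (b + (a' + b')) ≡⟨ cong (a +_) (sym (+-assoc b a' b')) ⟩
          a + ((b + a') + b') ≡⟨ cong (λ t → a + (t + b')) (+-comm b a') ⟩
          a + ((a' + b) + b') ≡⟨ cong (a +_) (+-assoc a' b b') ⟩
          a + (a' + (b + b')) ≡⟨ sym (+-assoc a a' (b + b')) ⟩
          (a + a') + (b + b') ∎
          where open ≡-Reasoning

    ·v-distrib : ∀ {m} c (a b : Vec K m) → c ·v (a +v b) ≡ c ·v a +v c ·v b
    ·v-distrib c [] [] = refl
    ·v-distrib c (a ∷ as) (b ∷ bs) = cong₂ _∷_ (distribˡ c a b) (·v-distrib c as bs)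

  record Subspace : Set₁ where
    field
      _∋_    : V → Set
      ∋-0    : _∋_ 0v
      ∋-+    : ∀ {u v} → _∋_ u → _∋_ v → _∋_ (u +v v)
      ∋-·    : ∀ c {v} → _∋_ v → _∋_ (c ·v v)
  open Subspace public

  _⊆_ : Subspace → Subspace → Set
  A ⊆ B = ∀ v → A ∋ v → B ∋ v

  zeroSpace : Subspace
  zeroSpace = record
    { _∋_ = λ v → v ≡ 0v
    ; ∋-0 = refl
    ; ∋-+ = λ { refl refl → sym +v-0 }
    ; ∋-· = λ { c refl → ·v-0 c } }

  E : Subspace
  E = record { _∋_ = λ _ → ⊤ ; ∋-0 = tt ; ∋-+ = λ _ _ → tt ; ∋-· = λ _ _ → tt }

  infixl 6 _⊕_
  _⊕_ : Subspace → Subspace → Subspace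
  A ⊕ B = record
    { _∋_ = λ v → Σ V λ a → Σ V λ b → A ∋ a × B ∋ b × v ≡ a +v b
    ; ∋-0 = 0v , 0v , ∋-0 A , ∋-0 B , +v-0
    ; ∋-+ = λ { (a , b , a∈ , b∈ , refl) (a' , b' , a'∈ , b'∈ , refl) →
                 a +v a' , b +v b' , ∋-+ A a∈ a'∈ , ∋-+ B b∈ b'∈
                 , +v-interchange a b a' b' }
    ; ∋-· = λ { c (a , b , a∈ , b∈ , refl) →
                 c ·v a , c ·v b , ∋-· A c a∈ , ∋-· B c b∈ , ·v-distrib c a b } }

  infixl 7 _∩_
  _∩_ : Subspace → Subspace → Subspace
  A ∩ B = record
    { _∋_ = λ v → A ∋ v × B ∋ v
    ; ∋-0 = ∋-0 A , ∋-0 B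
    ; ∋-+ = λ { (p , q) (p' , q') → ∋-+ A p p' , ∋-+ B q q' }
    ; ∋-· = λ { c (p , q) → ∋-· A c p , ∋-· B c q } }

  lincomb : ∀ {k} → Vec K k → Vec V k → V
  lincomb [] [] = 0v
  lincomb (c ∷ cs) (v ∷ vs) = c ·v v +v lincomb cs vs

  LinIndep : ∀ {k} → Vec V k → Set
  LinIndep vs = ∀ cs → lincomb cs vs ≡ 0v → ∀ i → lookup cs i ≡ 0#

  HasDim : Subspace → ℕ → Set
  HasDim A k = Σ (Vec V k) λ vs →
      (∀ i → A ∋ lookup vs i)
    × LinIndep vs
    × (∀ v → A ∋ v → Σ (Vec K k) λ cs → v ≡ lincomb cs vs)

  OneDim : Subspace → Set
  OneDim x = HasDim x 1

  Codim1In : Subspace → Subspace → Set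
  Codim1In H X = H ⊆ X × Σ ℕ λ k → HasDim X (suc k) × HasDim H k

  record QMatroid : Set₁ where
    field
      ρ          : Subspace → ℕ
      ρ≤dim      : ∀ A k → HasDim A k → ρ A ℕ.≤ k
      monotone   : ∀ A B → A ⊆ B → ρ A ℕ.≤ ρ B
      submodular : ∀ A B → ρ (A ⊕ B) ℕ.+ ρ (A ∩ B) ℕ.≤ ρ A ℕ.+ ρ B
  open QMatroid public

  IsLoop : QMatroid → Subspace → Set
  IsLoop M x = OneDim x × ρ M x ≡ 0

  NoLoops : QMatroid → Set₁
  NoLoops M = ∀ x → ¬ IsLoop M x

  RankFn : Set₁
  RankFn = Subspace → ℚ

  IsFlat : RankFn → Subspace → Set₁
  IsFlat r X = ∀ v → OneDim v → ¬ (v ⊆ X) → r X ℚ.< r (X ⊕ v)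

  IsCyclic : RankFn → Subspace → Set₁
  IsCyclic r X = ∀ H → Codim1In H X →
      r X ≡ r H
    ⊎ (ℚ.0ℚ ℚ.< r X ℚ.- r H
       × Σ Subspace λ a → OneDim a × a ⊆ X × ¬ (a ⊆ H)
           × r X ℚ.- r H ℚ.< r a)

  Full : RankFn → Set₁
  Full r = IsFlat r zeroSpace × IsCyclic r E

  combine : ℚ → QMatroid → ℚ → QMatroid → RankFn
  combine l₁ M₁ l₂ M₂ A =
    l₁ ℚ.* ((ℤ.+ ρ M₁ A) ℚ./ 1) ℚ.+ l₂ ℚ.* ((ℤ.+ ρ M₂ A) ℚ./ 1)

  FullQM : QMatroid → Set₁
  FullQM M = Full (λ A → (ℤ.+ ρ M A) ℚ./ 1)

{-# OPTIONS --safe #-}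
module Submission where

-- Since ⟨0⟩ is a flat of M₁, M₁ has no loops; since ρ₁ is integer-valued, cyclicity of E
-- forces ρ₁ H = ρ₁ E for every hyperplane H, as 0 < ρ₁ E - ρ₁ H < ρ₁ a ≤ 1 is impossible.
-- Hence r E - r H = λ₂ (ρ₂ E - ρ₂ H). A hyperplane and any vector outside it span E (Steinitz
-- exchange), so by submodularity ρ₂ E ≤ ρ₂ H + 1, and when ρ₂ E ≠ ρ₂ H some basis line a ⊄ H
-- raises ρ₂ H. As neither matroid has loops, r a = λ₁ + λ₂ > λ₂ = r E - r H. Flatness of ⟨0⟩
-- holds since r ⟨0⟩ = 0 while ρ₂ v = 1 for every line v.

open import Defs
open import Algebra.Bundles using (AbelianGroup; CommutativeRing)
open import Data.Empty using (⊥; ⊥-elim)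
open import Data.Fin using (Fin; zero; suc; punchIn)
open import Data.Fin.Properties using (any?)
open import Data.Nat as ℕ using (ℕ; zero; suc)
import Data.Nat.Properties as ℕP
open import Data.Product using (Σ; _×_; _,_; proj₁; proj₂)
open import Data.Sum using (inj₁; inj₂)
open import Data.Vec using (Vec; []; _∷_; lookup; map; replicate; tabulate)
open import Data.Vec.Functional as Vector using (Vector; insertAt; removeAt; tail)
open import Data.Vec.Functional.Properties using (insertAt-lookup; insertAt-punchIn)
open import Data.Vec.Properties
  using (zipWith-assoc; zipWith-comm; zipWith-identityˡ; zipWith-identityʳ;
         zipWith-inverseˡ; zipWith-inverseʳ; map-cong; map-∘; map-id; map-replicate;
         lookup∘tabulate)
open import Function using (_∘_)
open import Relation.Nullary using (¬_; yes; no)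
open import Relation.Nullary.Decidable using (decidable-stable)
open import Relation.Nullary.Negation using (contradiction; ¬¬-map)
open import Relation.Binary.PropositionalEquality

¬¬-∀-Fin : ∀ {p} {m} {P : Fin m → Set p} → (∀ t → ¬ ¬ P t) → ¬ ¬ (∀ t → P t)
¬¬-∀-Fin {m = zero}  _   ¬∀ = ¬∀ λ ()
¬¬-∀-Fin {m = suc m} ¬¬P ¬∀ =
  ¬¬P zero λ P₀ → ¬¬-∀-Fin (¬¬P ∘ suc) λ P₊ →
    ¬∀ λ { zero → P₀ ; (suc t) → P₊ t }

module LinearAlgebra (F : FiniteField) (n : ℕ) where
  open FiniteField F renaming (Carrier to K)
  open Space F n

  K-commutativeRing : CommutativeRing _ _
  K-commutativeRing = record { isCommutativeRing = isCommutativeRing }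

  open CommutativeRing K-commutativeRing
    using (+-assoc; +-comm; +-identityˡ; +-identityʳ; -‿inverseˡ; -‿inverseʳ;
           *-assoc; *-comm; *-identityˡ; *-identityʳ; zeroˡ; zeroʳ; distribˡ; distribʳ;
           +-monoid)
  open import Algebra.Properties.Ring (CommutativeRing.ring K-commutativeRing)
    using (-1*x≈-x; -‿distribˡ-*)
  open import Algebra.Properties.Monoid.Sum +-monoid using () renaming (sum to sumᴷ)

  infix 8 -v_
  -v_ : V → V
  -v_ = map -_

  V-abelianGroup : AbelianGroup _ _
  V-abelianGroup = record
    { isAbelianGroup = record
      { isGroup = record
        { isMonoid = record
          { isSemigroup = record
            { isMagma = record { isEquivalence = isEquivalence ; ∙-cong = cong₂ _+v_ }
            ; assoc = zipWith-assoc +-assoc }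
          ; identity = zipWith-identityˡ +-identityˡ , zipWith-identityʳ +-identityʳ }
        ; inverse = zipWith-inverseˡ -‿inverseˡ , zipWith-inverseʳ -‿inverseʳ
        ; ⁻¹-cong = cong -v_ }
      ; comm = zipWith-comm +-comm } }

  open AbelianGroup V-abelianGroup
    using () renaming (comm to +v-comm; identityˡ to +v-identityˡ; identityʳ to +v-identityʳ)
  open import Algebra.Properties.Group (AbelianGroup.group V-abelianGroup)
    using (inverseˡ-unique)
  open import Algebra.Properties.CommutativeMonoid.Sum
    (AbelianGroup.commutativeMonoid V-abelianGroup)
    using (sum; sum-remove; ∑-distrib-+; sum-cong-≗; sum-replicate-zero)

  ·v-distribˡ : ∀ {m} c (x y : Vec K m) → c ·v (x +v y) ≡ c ·v x +v c ·v y
  ·v-distribˡ c []       []       = refl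
  ·v-distribˡ c (x ∷ xs) (y ∷ ys) = cong₂ _∷_ (distribˡ c x y) (·v-distribˡ c xs ys)

  ·v-distribʳ : ∀ {m} c d (x : Vec K m) → (c + d) ·v x ≡ c ·v x +v d ·v x
  ·v-distribʳ c d []       = refl
  ·v-distribʳ c d (x ∷ xs) = cong₂ _∷_ (distribʳ x c d) (·v-distribʳ c d xs)

  ·v-zeroˡ : ∀ {m} (x : Vec K m) → 0# ·v x ≡ 0v
  ·v-zeroˡ []       = refl
  ·v-zeroˡ (x ∷ xs) = cong₂ _∷_ (zeroˡ x) (·v-zeroˡ xs)

  ·v-zeroʳ : ∀ c → c ·v 0v ≡ 0v
  ·v-zeroʳ c = trans (map-replicate (c *_) 0# n) (cong (replicate n) (zeroʳ c))

  ·v-assoc : ∀ c d (x : V) → (c * d) ·v x ≡ c ·v (d ·v x)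
  ·v-assoc c d x = trans (map-cong (*-assoc c d) x) (map-∘ (c *_) (d *_) x)

  ·v-identity : ∀ (x : V) → 1# ·v x ≡ x
  ·v-identity x = trans (map-cong *-identityˡ x) (map-id x)

  -v≡-1·v : ∀ (x : V) → -v x ≡ (- 1#) ·v x
  -v≡-1·v x = map-cong (λ c → sym (-1*x≈-x c)) x

  lc : ∀ {m} → Vector K m → Vector V m → V
  lc a w = sum λ t → a t ·v w t

  InSpan : ∀ {p} → Vector V p → V → Set
  InSpan {p} w v = Σ (Vector K p) λ d → v ≡ lc d w

  lincomb≡lc : ∀ {k} (cs : Vec K k) (vs : Vec V k) →
               lincomb cs vs ≡ lc (lookup cs) (lookup vs)
  lincomb≡lc []       []       = refl
  lincomb≡lc (c ∷ cs) (v ∷ vs) = cong (c ·v v +v_) (lincomb≡lc cs vs)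

  sum-closed : ∀ (S : Subspace) {m} (f : Vector V m) → (∀ t → S ∋ f t) → S ∋ sum f
  sum-closed S {zero}  f f∈S = ∋-0 S
  sum-closed S {suc m} f f∈S = ∋-+ S (f∈S zero) (sum-closed S (tail f) (f∈S ∘ suc))

  lc-closed : ∀ (S : Subspace) {m} (a : Vector K m) (w : Vector V m) →
              (∀ t → S ∋ w t) → S ∋ lc a w
  lc-closed S a w w∈S = sum-closed S _ λ t → ∋-· S (a t) (w∈S t)

  ·v-sum : ∀ {m} c (f : Vector V m) → c ·v sum f ≡ sum (λ t → c ·v f t)
  ·v-sum {zero}  c f = ·v-zeroʳ c
  ·v-sum {suc m} c f =
    trans (·v-distribˡ c _ _) (cong (c ·v f zero +v_) (·v-sum c (tail f)))

  sumᴷ-·v : ∀ {m} (c : Vector K m) (x : V) → sumᴷ c ·v x ≡ sum (λ t → c t ·v x)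
  sumᴷ-·v {zero}  c x = ·v-zeroˡ x
  sumᴷ-·v {suc m} c x =
    trans (·v-distribʳ _ _ x) (cong (c zero ·v x +v_) (sumᴷ-·v (tail c) x))

  lc-zero : ∀ {m} (w : Vector V m) → lc (λ _ → 0#) w ≡ 0v
  lc-zero {m} w = trans (sum-cong-≗ (·v-zeroˡ ∘ w)) (sum-replicate-zero m)

  lc-head-zero : ∀ {m} (a : Vector K (suc m)) (w : Vector V (suc m)) →
                 a zero ≡ 0# → lc a w ≡ lc (tail a) (tail w)
  lc-head-zero a w a₀≡0 = begin
    a zero ·v w zero +v rest ≡⟨ cong (λ c → c ·v w zero +v rest) a₀≡0 ⟩
    0# ·v w zero +v rest     ≡⟨ cong (_+v rest) (·v-zeroˡ (w zero)) ⟩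
    0v +v rest               ≡⟨ +v-identityˡ rest ⟩
    rest                     ∎
    where
    open ≡-Reasoning
    rest : V
    rest = lc (tail a) (tail w)

  lc-insertAt : ∀ {m} (a : Vector K m) s κ (w : Vector V (suc m)) →
                lc (insertAt a s κ) w ≡ κ ·v w s +v lc a (removeAt w s)
  lc-insertAt a s κ w = begin
    lc (insertAt a s κ) w
      ≡⟨ sum-remove {i = s} (λ t → insertAt a s κ t ·v w t) ⟩
    insertAt a s κ s ·v w s +v lc (removeAt (insertAt a s κ) s) (removeAt w s)
      ≡⟨ cong₂ _+v_
           (cong (_·v w s) (insertAt-lookup a s κ))
           (sum-cong-≗ λ t → cong (_·v w (punchIn s t)) (insertAt-punchIn a s κ t)) ⟩
    κ ·v w s +v lc a (removeAt w s) ∎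
    where open ≡-Reasoning

  lc-single : ∀ {m} (i : Fin (suc m)) c (w : Vector V (suc m)) →
              lc (insertAt (λ _ → 0#) i c) w ≡ c ·v w i
  lc-single i c w = begin
    lc (insertAt (λ _ → 0#) i c) w           ≡⟨ lc-insertAt (λ _ → 0#) i c w ⟩
    c ·v w i +v lc (λ _ → 0#) (removeAt w i) ≡⟨ cong (c ·v w i +v_) (lc-zero (removeAt w i)) ⟩
    c ·v w i +v 0v                           ≡⟨ +v-identityʳ (c ·v w i) ⟩
    c ·v w i                                 ∎
    where open ≡-Reasoning

  lc-+· : ∀ {m} (a b : Vector K m) k (w : Vector V m) →
          lc a w +v k ·v lc b w ≡ lc (λ j → a j + k * b j) w
  lc-+· a b k w = begin
    lc a w +v k ·v lc b w
      ≡⟨ cong (lc a w +v_) (·v-sum k (λ j → b j ·v w j)) ⟩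
    lc a w +v sum (λ j → k ·v (b j ·v w j))
      ≡⟨ sym (∑-distrib-+ (λ j → a j ·v w j) _) ⟩
    sum (λ j → a j ·v w j +v k ·v (b j ·v w j))
      ≡⟨ sum-cong-≗ (λ j → cong (a j ·v w j +v_) (sym (·v-assoc k (b j) (w j)))) ⟩
    sum (λ j → a j ·v w j +v (k * b j) ·v w j)
      ≡⟨ sum-cong-≗ (λ j → sym (·v-distribʳ (a j) (k * b j) (w j))) ⟩
    lc (λ j → a j + k * b j) w ∎
    where open ≡-Reasoning

  lc-shear : ∀ {m} (a : Vector K m) (x : Vector V m) (k : Vector K m) (y : V) →
             lc a (λ t → x t +v k t ·v y) ≡ lc a x +v sumᴷ (λ t → a t * k t) ·v y
  lc-shear a x k y = begin
    lc a (λ t → x t +v k t ·v y)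
      ≡⟨ sum-cong-≗ (λ t → ·v-distribˡ (a t) (x t) (k t ·v y)) ⟩
    sum (λ t → a t ·v x t +v a t ·v (k t ·v y))
      ≡⟨ sum-cong-≗ (λ t → cong (a t ·v x t +v_) (sym (·v-assoc (a t) (k t) y))) ⟩
    sum (λ t → a t ·v x t +v (a t * k t) ·v y)
      ≡⟨ ∑-distrib-+ (λ t → a t ·v x t) _ ⟩
    lc a x +v sum (λ t → (a t * k t) ·v y)
      ≡⟨ cong (lc a x +v_) (sym (sumᴷ-·v (λ t → a t * k t) y)) ⟩
    lc a x +v sumᴷ (λ t → a t * k t) ·v y ∎
    where open ≡-Reasoning

  ∋-solve : ∀ (S : Subspace) {a x y} → a ·v x +v y ≡ 0v → a ≢ 0# → S ∋ y → S ∋ x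
  ∋-solve S {a} {x} {y} a·x+y≡0 a≢0 y∈S =
    subst (S ∋_) (sym x≡) (∋-· S a⁻¹ (subst (S ∋_) (sym (-v≡-1·v y)) (∋-· S (- 1#) y∈S)))
    where
    a⁻¹ : K
    a⁻¹ = proj₁ (inverse a a≢0)
    x≡ : x ≡ a⁻¹ ·v -v y
    x≡ = begin
      x               ≡⟨ sym (·v-identity x) ⟩
      1# ·v x         ≡⟨ cong (_·v x) (sym (trans (*-comm a⁻¹ a) (proj₂ (inverse a a≢0)))) ⟩
      (a⁻¹ * a) ·v x  ≡⟨ ·v-assoc a⁻¹ a x ⟩
      a⁻¹ ·v (a ·v x) ≡⟨ cong (a⁻¹ ·v_) (inverseˡ-unique (a ·v x) y a·x+y≡0) ⟩
      a⁻¹ ·v -v y     ∎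
      where open ≡-Reasoning

  pivot-cancel : ∀ x {y z} → z * y ≡ 1# → x + (- (x * y)) * z ≡ 0#
  pivot-cancel x {y} {z} zy≡1 = begin
    x + (- (x * y)) * z ≡⟨ cong (x +_) (sym (-‿distribˡ-* (x * y) z)) ⟩
    x + - ((x * y) * z) ≡⟨ cong (λ c → x + - c) (*-assoc x y z) ⟩
    x + - (x * (y * z)) ≡⟨ cong (λ c → x + - (x * c)) (trans (*-comm y z) zy≡1) ⟩
    x + - (x * 1#)      ≡⟨ cong (λ c → x + - c) (*-identityʳ x) ⟩
    x + - x             ≡⟨ -‿inverseʳ x ⟩
    0#                  ∎
    where open ≡-Reasoning

  -- Equality in F is not decidable, so adjoining a vector outside a subspace
  -- preserves independence only in this double-negated form.
  WeaklyIndependent : ∀ {m} → Vector V m → Set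
  WeaklyIndependent u = ∀ a → lc a u ≡ 0v → ∀ t → ¬ ¬ (a t ≡ 0#)

  linIndep-lc : ∀ {k} {e : Vec V k} → LinIndep e →
                ∀ a → lc a (lookup e) ≡ 0v → ∀ t → a t ≡ 0#
  linIndep-lc {e = e} indep a lc≡0 t =
    trans (sym (lookup∘tabulate a t)) (indep (tabulate a) lincomb≡0 t)
    where
    lincomb≡0 : lincomb (tabulate a) e ≡ 0v
    lincomb≡0 = trans (lincomb≡lc (tabulate a) e)
      (trans (sum-cong-≗ λ j → cong (_·v lookup e j) (lookup∘tabulate a j)) lc≡0)

  linIndep⇒weaklyIndependent : ∀ {k} {e : Vec V k} → LinIndep e →
                               WeaklyIndependent (lookup e)
  linIndep⇒weaklyIndependent indep a lc≡0 t a≢0 = a≢0 (linIndep-lc indep a lc≡0 t)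

  weaklyIndependent-nonzero : ∀ {m} {u : Vector V (suc m)} → WeaklyIndependent u →
                              ∀ t → u t ≢ 0v
  weaklyIndependent-nonzero {u = u} indep t uₜ≡0 =
    indep (insertAt (λ _ → 0#) t 1#) lc≡0 t 1≢0
    where
    lc≡0 : lc (insertAt (λ _ → 0#) t 1#) u ≡ 0v
    lc≡0 = trans (lc-single t 1# u) (trans (·v-identity (u t)) uₜ≡0)
    1≢0 : insertAt (λ _ → 0#) t 1# t ≢ 0#
    1≢0 1≡0 = 0≢1 (sym (trans (sym (insertAt-lookup _ t 1#)) 1≡0))

  weaklyIndependent-cons : ∀ (S : Subspace) {m} {v} {w : Vector V m} →
    (∀ t → S ∋ w t) → WeaklyIndependent w → ¬ S ∋ v → WeaklyIndependent (v Vector.∷ w)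
  weaklyIndependent-cons S {v = v} {w} w∈S indep v∉S a lc≡0 = λ
    { zero    → head≡0
    ; (suc t) → λ aₜ≢0 → head≡0 λ a₀≡0 →
        indep (tail a) (trans (sym (lc-head-zero a (v Vector.∷ w) a₀≡0)) lc≡0) t aₜ≢0 }
    where
    head≡0 : ¬ ¬ (a zero ≡ 0#)
    head≡0 a₀≢0 = v∉S (∋-solve S lc≡0 a₀≢0 (lc-closed S (tail a) w w∈S))

  weaklyIndependent-shear : ∀ {m} {u : Vector V (suc m)} → WeaklyIndependent u →
    ∀ s (k : Vector K m) → WeaklyIndependent (λ t → u (punchIn s t) +v k t ·v u s)
  weaklyIndependent-shear {u = u} indep s k a lc≡0 t =
    subst (λ c → ¬ ¬ (c ≡ 0#)) (insertAt-punchIn a s κ t)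
          (indep (insertAt a s κ) lc-extended≡0 (punchIn s t))
    where
    κ : K
    κ = sumᴷ (λ t → a t * k t)
    lc-extended≡0 : lc (insertAt a s κ) u ≡ 0v
    lc-extended≡0 = begin
      lc (insertAt a s κ) u                      ≡⟨ lc-insertAt a s κ u ⟩
      κ ·v u s +v lc a (removeAt u s)            ≡⟨ +v-comm (κ ·v u s) _ ⟩
      lc a (removeAt u s) +v κ ·v u s            ≡⟨ sym (lc-shear a (removeAt u s) k (u s)) ⟩
      lc a (λ t → u (punchIn s t) +v k t ·v u s) ≡⟨ lc≡0 ⟩
      0v                                         ∎
      where open ≡-Reasoning

  steinitz : ∀ p {m} → p ℕ.< m → (u : Vector V m) (w : Vector V p) →
             (∀ t → InSpan w (u t)) → WeaklyIndependent u → ⊥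
  steinitz zero    {suc m} _            u w span indep =
    weaklyIndependent-nonzero {u = u} indep zero (proj₂ (span zero))
  steinitz (suc p) {suc m} (ℕ.s≤s p<m) u w span indep = ¬¬-∀-Fin pivot-on drop-head
    where
    d : Fin (suc m) → Vector K (suc p)
    d t = proj₁ (span t)
    c : Vector K (suc m)
    c t = d t zero

    drop-head : (∀ t → c t ≡ 0#) → ⊥
    drop-head c≡0 = steinitz p (ℕP.m<n⇒m<1+n p<m) u (tail w)
      (λ t → tail (d t) , trans (proj₂ (span t)) (lc-head-zero (d t) w (c≡0 t))) indep

    -- If c s ≢ 0, subtracting multiples of u s removes w₀ from the other vectors.
    pivot-on : ∀ s → ¬ ¬ (c s ≡ 0#)
    pivot-on s cₛ≢0 =
      steinitz p p<m u′ (tail w) span′ (weaklyIndependent-shear {u = u} indep s k)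
      where
      cₛ⁻¹ : K
      cₛ⁻¹ = proj₁ (inverse (c s) cₛ≢0)
      k : Vector K m
      k t = - (c (punchIn s t) * cₛ⁻¹)
      u′ : Vector V m
      u′ t = u (punchIn s t) +v k t ·v u s
      span′ : ∀ t → InSpan (tail w) (u′ t)
      span′ t = tail d′ , (begin
        u′ t
          ≡⟨ cong₂ (λ x y → x +v k t ·v y) (proj₂ (span (punchIn s t))) (proj₂ (span s)) ⟩
        lc (d (punchIn s t)) w +v k t ·v lc (d s) w
          ≡⟨ lc-+· (d (punchIn s t)) (d s) (k t) w ⟩
        lc d′ w
          ≡⟨ lc-head-zero d′ w (pivot-cancel _ (proj₂ (inverse (c s) cₛ≢0))) ⟩
        lc (tail d′) (tail w) ∎)
        where
        open ≡-Reasoning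
        d′ : Vector K (suc p)
        d′ j = d (punchIn s t) j + k t * d s j

  line : V → Subspace
  line v = record
    { _∋_ = λ x → Σ K λ c → x ≡ c ·v v
    ; ∋-0 = 0# , sym (·v-zeroˡ v)
    ; ∋-+ = λ { (c , refl) (d , refl) → c + d , sym (·v-distribʳ c d v) }
    ; ∋-· = λ { c (d , refl) → c * d , sym (·v-assoc c d v) } }

  line-∋ : ∀ v → line v ∋ v
  line-∋ v = 1# , sym (·v-identity v)

  line-least : ∀ S {v} → S ∋ v → line v ⊆ S
  line-least S v∈S x (c , x≡cv) = subst (S ∋_) (sym x≡cv) (∋-· S c v∈S)

  ⊕-inl : ∀ A B → A ⊆ (A ⊕ B)
  ⊕-inl A B x x∈A = x , 0v , x∈A , ∋-0 B , sym (+v-identityʳ x)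

  ⊕-inr : ∀ A B → B ⊆ (A ⊕ B)
  ⊕-inr A B x x∈B = 0v , x , ∋-0 A , x∈B , sym (+v-identityˡ x)

  ⊕-least : ∀ {A B} C → A ⊆ C → B ⊆ C → (A ⊕ B) ⊆ C
  ⊕-least C A⊆C B⊆C x (a , b , a∈A , b∈B , x≡a+b) =
    subst (C ∋_) (sym x≡a+b) (∋-+ C (A⊆C a a∈A) (B⊆C b b∈B))

  zeroSpace-least : ∀ A → zeroSpace ⊆ A
  zeroSpace-least A x x≡0 = subst (A ∋_) (sym x≡0) (∋-0 A)

  dim-zeroSpace : HasDim zeroSpace 0
  dim-zeroSpace = [] , (λ ()) , (λ _ _ ()) , (λ v v≡0 → [] , v≡0)

  Spans : ∀ {k} → Subspace → Vec V k → Set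
  Spans {k} X e = ∀ v → X ∋ v → Σ (Vec K k) λ cs → v ≡ lincomb cs e

  spans-InSpan : ∀ {k X} {e : Vec V k} → Spans X e →
                 ∀ {x} → X ∋ x → InSpan (lookup e) x
  spans-InSpan {e = e} span {x} x∈X =
    lookup cs , trans (proj₂ (span x x∈X)) (lincomb≡lc cs e)
    where
    cs : Vec K _
    cs = proj₁ (span x x∈X)

  spans-⊆ : ∀ {k X} {e : Vec V k} → Spans X e → ∀ S → (∀ j → S ∋ lookup e j) → X ⊆ S
  spans-⊆ {X = X} {e} span S e∈S x x∈X =
    subst (S ∋_) (sym (proj₂ (spans-InSpan {X = X} {e} span x∈X)))
          (lc-closed S _ (lookup e) e∈S)

  oneDim-line : ∀ {k} {e : Vec V (suc k)} → LinIndep e → ∀ i → OneDim (line (lookup e i))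
  oneDim-line {e = e} indep i =
    (lookup e i ∷ []) , (λ { zero → line-∋ (lookup e i) }) , indep₁ , span₁
    where
    indep₁ : LinIndep (lookup e i ∷ [])
    indep₁ (c ∷ []) c·eᵢ+0≡0 zero =
      trans (sym (insertAt-lookup _ i c))
            (linIndep-lc indep (insertAt (λ _ → 0#) i c) lc≡0 i)
      where
      lc≡0 : lc (insertAt (λ _ → 0#) i c) (lookup e) ≡ 0v
      lc≡0 = trans (lc-single i c (lookup e)) (trans (sym (+v-identityʳ _)) c·eᵢ+0≡0)
    span₁ : Spans (line (lookup e i)) (lookup e i ∷ [])
    span₁ x (c , x≡) = (c ∷ []) , trans x≡ (sym (+v-identityʳ _))

  oneDim-⊈-zeroSpace : ∀ {a} → OneDim a → ¬ (a ⊆ zeroSpace)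
  oneDim-⊈-zeroSpace ((v ∷ []) , v∈a , indep , _) a⊆0 =
    weaklyIndependent-nonzero {u = lookup (v ∷ [])}
      (linIndep⇒weaklyIndependent indep) zero (a⊆0 v (v∈a zero))

  codim1-⊕-line : ∀ {H X v} → Codim1In H X → X ∋ v → ¬ H ∋ v →
                  ∀ {x} → X ∋ x → ¬ ¬ ((H ⊕ line v) ∋ x)
  codim1-⊕-line {H} {X} {v} (H⊆X , k , (e , _ , _ , spanX) , (h , h∈H , indepH , _))
                v∈X v∉H {x} x∈X x∉ =
    steinitz (suc k) ℕP.≤-refl u (lookup e)
      (λ t → spans-InSpan {X = X} {e} spanX (u∈X t))
      (weaklyIndependent-cons (H ⊕ line v) vh∈
        (weaklyIndependent-cons H h∈H (linIndep⇒weaklyIndependent indepH) v∉H) x∉)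
    where
    u : Vector V (suc (suc k))
    u = x Vector.∷ v Vector.∷ lookup h
    u∈X : ∀ t → X ∋ u t
    u∈X zero          = x∈X
    u∈X (suc zero)    = v∈X
    u∈X (suc (suc t)) = H⊆X _ (h∈H t)
    vh∈ : ∀ t → (H ⊕ line v) ∋ (v Vector.∷ lookup h) t
    vh∈ zero    = ⊕-inr H (line v) v (line-∋ v)
    vh∈ (suc t) = ⊕-inl H (line v) _ (h∈H t)

module Rank (F : FiniteField) (n : ℕ) (M : Space.QMatroid F n) where
  open Space F n
  open LinearAlgebra F n
  open import Data.Nat using (_≤_; _<_; _+_; _≤?_; _<?_)

  ρ-zeroSpace : ρ M zeroSpace ≡ 0
  ρ-zeroSpace = ℕP.n≤0⇒n≡0 (ρ≤dim M zeroSpace 0 dim-zeroSpace)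

  ρ-⊕-≤ : ∀ A B → ρ M (A ⊕ B) ≤ ρ M A + ρ M B
  ρ-⊕-≤ A B = ℕP.≤-trans (ℕP.m≤m+n _ _) (submodular M A B)

  ρ-⊕-line-≤ : ∀ H {a} → OneDim a → ρ M (H ⊕ a) ≤ suc (ρ M H)
  ρ-⊕-line-≤ H {a} dim-a = begin
    ρ M (H ⊕ a)     ≤⟨ ρ-⊕-≤ H a ⟩
    ρ M H + ρ M a   ≤⟨ ℕP.+-monoʳ-≤ (ρ M H) (ρ≤dim M a 1 dim-a) ⟩
    ρ M H + 1       ≡⟨ ℕP.+-comm (ρ M H) 1 ⟩
    suc (ρ M H)     ∎
    where open ℕP.≤-Reasoning

  noLoops⇒ρ-oneDim≡1 : NoLoops M → ∀ {a} → OneDim a → ρ M a ≡ 1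
  noLoops⇒ρ-oneDim≡1 loopless {a} dim-a =
    ℕP.≤-antisym (ρ≤dim M a 1 dim-a) (ℕP.n≢0⇒n>0 λ ρa≡0 → loopless a (dim-a , ρa≡0))

  ρ-⊕-≤-common : ∀ {H A B} → H ⊆ A → H ⊆ B → ρ M A ≤ ρ M H → ρ M B ≤ ρ M H →
                 ρ M (A ⊕ B) ≤ ρ M H
  ρ-⊕-≤-common {H} {A} {B} H⊆A H⊆B ρA≤ ρB≤ = ℕP.+-cancelʳ-≤ (ρ M H) _ _ (begin
    ρ M (A ⊕ B) + ρ M H        ≤⟨ ℕP.+-monoʳ-≤ (ρ M (A ⊕ B)) (monotone M H (A ∩ B) H⊆A∩B) ⟩
    ρ M (A ⊕ B) + ρ M (A ∩ B)  ≤⟨ submodular M A B ⟩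
    ρ M A + ρ M B              ≤⟨ ℕP.+-mono-≤ ρA≤ ρB≤ ⟩
    ρ M H + ρ M H              ∎)
    where
    open ℕP.≤-Reasoning
    H⊆A∩B : H ⊆ (A ∩ B)
    H⊆A∩B x x∈H = H⊆A x x∈H , H⊆B x x∈H

  infixl 6 _⊕lines_
  _⊕lines_ : ∀ {j} → Subspace → Vec V j → Subspace
  H ⊕lines []       = H
  H ⊕lines (v ∷ vs) = line v ⊕ (H ⊕lines vs)

  ⊆-⊕lines : ∀ H {j} (vs : Vec V j) → H ⊆ (H ⊕lines vs)
  ⊆-⊕lines H []       x x∈H = x∈H
  ⊆-⊕lines H (v ∷ vs) x x∈H = ⊕-inr (line v) (H ⊕lines vs) x (⊆-⊕lines H vs x x∈H)

  lookup-∈-⊕lines : ∀ H {j} (vs : Vec V j) i → (H ⊕lines vs) ∋ lookup vs i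
  lookup-∈-⊕lines H (v ∷ vs) zero    = ⊕-inl (line v) (H ⊕lines vs) v (line-∋ v)
  lookup-∈-⊕lines H (v ∷ vs) (suc i) =
    ⊕-inr (line v) (H ⊕lines vs) (lookup vs i) (lookup-∈-⊕lines H vs i)

  ρ-⊕lines-≤ : ∀ H {j} (vs : Vec V j) → (∀ i → ρ M (H ⊕ line (lookup vs i)) ≤ ρ M H) →
               ρ M (H ⊕lines vs) ≤ ρ M H
  ρ-⊕lines-≤ H []       _     = ℕP.≤-refl
  ρ-⊕lines-≤ H (v ∷ vs) bound = ℕP.≤-trans (monotone M _ _ regroup)
    (ρ-⊕-≤-common (⊕-inl H (line v)) (⊆-⊕lines H vs)
                  (bound zero) (ρ-⊕lines-≤ H vs (bound ∘ suc)))
    where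
    regroup : (line v ⊕ (H ⊕lines vs)) ⊆ ((H ⊕ line v) ⊕ (H ⊕lines vs))
    regroup = ⊕-least {line v} {H ⊕lines vs} ((H ⊕ line v) ⊕ (H ⊕lines vs))
      (λ x x∈ → ⊕-inl (H ⊕ line v) (H ⊕lines vs) x (⊕-inr H (line v) x x∈))
      (⊕-inr (H ⊕ line v) (H ⊕lines vs))

  ρ-spanned-≤ : ∀ {H X k} {e : Vec V k} → Spans X e →
                (∀ i → ρ M (H ⊕ line (lookup e i)) ≤ ρ M H) → ρ M X ≤ ρ M H
  ρ-spanned-≤ {H} {X} {e = e} span bound = ℕP.≤-trans
    (monotone M X (H ⊕lines e)
      (spans-⊆ {X = X} {e} span (H ⊕lines e) (lookup-∈-⊕lines H e)))
    (ρ-⊕lines-≤ H e bound)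

  codim1-rank-step : ∀ {H X} → Codim1In H X → ρ M X ≢ ρ M H →
    ρ M X ≡ suc (ρ M H) × Σ Subspace λ a → OneDim a × a ⊆ X × ¬ (a ⊆ H)
  codim1-rank-step {H} {X} codim@(H⊆X , k , (e , e∈X , indep , span) , _) ρX≢ρH
    with any? (λ i → ρ M H <? ρ M (H ⊕ line (lookup e i)))
  ... | no none = contradiction
    (ℕP.≤-antisym (ρ-spanned-≤ {X = X} {e = e} span λ i → ℕP.≮⇒≥ λ lt → none (i , lt))
                  (monotone M H X H⊆X))
    ρX≢ρH
  ... | yes (i , raises) =
    ℕP.≤-antisym ρX≤ (ℕP.≤∧≢⇒< (monotone M H X H⊆X) (ρX≢ρH ∘ sym)) ,
    a , oneDim-line indep i , line-least X (e∈X i) , a⊈H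
    where
    a : Subspace
    a = line (lookup e i)
    a⊈H : ¬ (a ⊆ H)
    a⊈H a⊆H = ℕP.<⇒≱ raises (monotone M (H ⊕ a) H (⊕-least {H} {a} H (λ _ x∈H → x∈H) a⊆H))
    X⊆H⊕a : ¬ ¬ (X ⊆ (H ⊕ a))
    X⊆H⊕a = ¬¬-map (spans-⊆ {X = X} {e} span (H ⊕ a)) (¬¬-∀-Fin λ j →
      codim1-⊕-line {H} {X} {lookup e i} codim (e∈X i) (a⊈H ∘ line-least H) (e∈X j))
    ρX≤ : ρ M X ≤ suc (ρ M H)
    ρX≤ = decidable-stable (_ ≤? _) (¬¬-map (λ X⊆H⊕a →
      ℕP.≤-trans (monotone M X (H ⊕ a) X⊆H⊕a) (ρ-⊕-line-≤ H (oneDim-line indep i))) X⊆H⊕a)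

open import Data.Integer as ℤ using ()
import Data.Integer.Properties as ℤP
open import Data.Nat.Divisibility using (∣1⇒≡1)
open import Data.Rational as ℚ using (ℚ; mkℚ; 0ℚ; 1ℚ; _<_; _≤_; _+_; _*_; _-_; ↥_)
import Data.Rational.Properties as ℚP
import Data.Rational.Unnormalised as ℚᵘ
import Data.Rational.Unnormalised.Properties as ℚᵘP
open import Data.Rational.Solver using (module +-*-Solver)
open +-*-Solver

fromℕ : ℕ → ℚ
fromℕ m = (ℤ.+ m) ℚ./ 1

fromℕ-mkℚ : ∀ m → fromℕ m ≡ mkℚ (ℤ.+ m) 0 (λ p → ∣1⇒≡1 (proj₂ p))
fromℕ-mkℚ m = ℚP.normalize-coprime (λ p → ∣1⇒≡1 (proj₂ p))

fromℕ-injective : ∀ {a b} → fromℕ a ≡ fromℕ b → a ≡ b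
fromℕ-injective {a} {b} eq =
  ℤP.+-injective (cong ↥_ (trans (sym (fromℕ-mkℚ a)) (trans eq (fromℕ-mkℚ b))))

fromℕ-mono-≤ : ∀ {a b} → a ℕ.≤ b → fromℕ a ≤ fromℕ b
fromℕ-mono-≤ {a} {b} a≤b rewrite fromℕ-mkℚ a | fromℕ-mkℚ b =
  ℚ.*≤* (subst₂ ℤ._≤_ (sym (ℤP.*-identityʳ _)) (sym (ℤP.*-identityʳ _)) (ℤ.+≤+ a≤b))

fromℕ-mono-< : ∀ {a b} → a ℕ.< b → fromℕ a < fromℕ b
fromℕ-mono-< {a} {b} a<b rewrite fromℕ-mkℚ a | fromℕ-mkℚ b =
  ℚ.*<* (subst₂ ℤ._<_ (sym (ℤP.*-identityʳ _)) (sym (ℤP.*-identityʳ _)) (ℤ.+<+ a<b))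

fromℕ-cancel-< : ∀ {a b} → fromℕ a < fromℕ b → a ℕ.< b
fromℕ-cancel-< lt = ℕP.≰⇒> λ b≤a → ℚP.<-irrefl refl (ℚP.<-≤-trans lt (fromℕ-mono-≤ b≤a))

fromℕ-+ : ∀ a b → fromℕ (a ℕ.+ b) ≡ fromℕ a + fromℕ b
fromℕ-+ a b = ℚP.toℚᵘ-injective
  (ℚᵘP.≃-trans toℚᵘ-fromℕ-+ (ℚᵘP.≃-sym (ℚP.toℚᵘ-homo-+ (fromℕ a) (fromℕ b))))
  where
  toℚᵘ-fromℕ-+ : ℚ.toℚᵘ (fromℕ (a ℕ.+ b)) ℚᵘ.≃ ℚ.toℚᵘ (fromℕ a) ℚᵘ.+ ℚ.toℚᵘ (fromℕ b)
  toℚᵘ-fromℕ-+ rewrite fromℕ-mkℚ a | fromℕ-mkℚ b | fromℕ-mkℚ (a ℕ.+ b) =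
    ℚᵘ.*≡* (cong (ℤ._* ℤ.+ 1)
      (sym (cong₂ ℤ._+_ (ℤP.*-identityʳ (ℤ.+ a)) (ℤP.*-identityʳ (ℤ.+ b)))))

fromℕ-∸ : ∀ {a b} → a ℕ.≤ b → fromℕ b - fromℕ a ≡ fromℕ (b ℕ.∸ a)
fromℕ-∸ {a} {b} a≤b = begin
  fromℕ b - fromℕ a
    ≡⟨ cong (λ c → fromℕ c - fromℕ a) (sym (ℕP.m+[n∸m]≡n a≤b)) ⟩
  fromℕ (a ℕ.+ (b ℕ.∸ a)) - fromℕ a
    ≡⟨ cong (_- fromℕ a) (fromℕ-+ a (b ℕ.∸ a)) ⟩
  (fromℕ a + fromℕ (b ℕ.∸ a)) - fromℕ a
    ≡⟨ solve 2 (λ p q → (p :+ q) :- p := q) refl (fromℕ a) (fromℕ (b ℕ.∸ a)) ⟩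
  fromℕ (b ℕ.∸ a) ∎
  where open ≡-Reasoning

module IntegralRank (F : FiniteField) (n : ℕ) (M : Space.QMatroid F n) where
  open Space F n
  open LinearAlgebra F n
  open Rank F n M

  ρℚ : RankFn
  ρℚ A = fromℕ (ρ M A)

  flat-zeroSpace⇒noLoops : IsFlat ρℚ zeroSpace → NoLoops M
  flat-zeroSpace⇒noLoops flat a (dim-a , ρa≡0) =
    ℕP.<⇒≱ (fromℕ-cancel-< {ρ M zeroSpace} {ρ M (zeroSpace ⊕ a)} ρ0<ρ[0⊕a]) ρ[0⊕a]≤ρ0
    where
    ρ0<ρ[0⊕a] : ρℚ zeroSpace < ρℚ (zeroSpace ⊕ a)
    ρ0<ρ[0⊕a] = flat a dim-a (oneDim-⊈-zeroSpace {a} dim-a)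
    ρ[0⊕a]≤ρ0 : ρ M (zeroSpace ⊕ a) ℕ.≤ ρ M zeroSpace
    ρ[0⊕a]≤ρ0 = ℕP.≤-trans
      (monotone M _ a (⊕-least {zeroSpace} {a} a (zeroSpace-least a) (λ _ x∈a → x∈a)))
      (ℕP.≤-trans (ℕP.≤-reflexive ρa≡0) ℕ.z≤n)

  cyclic⇒ρ-codim1-constant : ∀ {X H} → IsCyclic ρℚ X → Codim1In H X → ρ M X ≡ ρ M H
  cyclic⇒ρ-codim1-constant {X} {H} cyclic codim@(H⊆X , _) with cyclic H codim
  ... | inj₁ ρX≡ρH = fromℕ-injective ρX≡ρH
  ... | inj₂ (0<Δ , a , dim-a , _ , _ , Δ<ρa) =
    ⊥-elim (ℕP.<⇒≱ (fromℕ-cancel-< {0} 0<d)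
                   (ℕP.≤-pred (ℕP.<-≤-trans d<ρa (ρ≤dim M a 1 dim-a))))
    where
    d : ℕ
    d = ρ M X ℕ.∸ ρ M H
    Δ≡d : ρℚ X - ρℚ H ≡ fromℕ d
    Δ≡d = fromℕ-∸ (monotone M H X H⊆X)
    0<d : fromℕ 0 < fromℕ d
    0<d = subst (0ℚ <_) Δ≡d 0<Δ
    d<ρa : d ℕ.< ρ M a
    d<ρa = fromℕ-cancel-< {d} (subst (_< ρℚ a) Δ≡d Δ<ρa)

module Combination (F : FiniteField) (n : ℕ) (M₁ M₂ : Space.QMatroid F n)
                   (l₁ l₂ : ℚ) (0<l₁ : 0ℚ < l₁) (0<l₂ : 0ℚ < l₂) where
  open Space F n
  open LinearAlgebra F n
  open Rank F n using (ρ-zeroSpace; noLoops⇒ρ-oneDim≡1; codim1-rank-step)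
  open IntegralRank F n using (ρℚ; cyclic⇒ρ-codim1-constant)

  weighted : ℕ → ℕ → ℚ
  weighted x y = l₁ * fromℕ x + l₂ * fromℕ y

  r : RankFn
  r = combine l₁ M₁ l₂ M₂

  weighted-zero : weighted 0 0 ≡ 0ℚ
  weighted-zero = trans (cong₂ _+_ (ℚP.*-zeroʳ l₁) (ℚP.*-zeroʳ l₂)) (ℚP.+-identityʳ 0ℚ)

  weighted-pos : ∀ x {y} → 0 ℕ.< y → 0ℚ < weighted x y
  weighted-pos x {y} 0<y = ℚP.+-mono-≤-< 0≤l₁x 0<l₂y
    where
    0≤l₁x : 0ℚ ≤ l₁ * fromℕ x
    0≤l₁x = subst (_≤ l₁ * fromℕ x) (ℚP.*-zeroʳ l₁)
      (ℚP.*-monoˡ-≤-nonNeg l₁ {{ℚP.pos⇒nonNeg l₁ {{ℚ.positive 0<l₁}}}} (fromℕ-mono-≤ {0} {x} ℕ.z≤n))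
    0<l₂y : 0ℚ < l₂ * fromℕ y
    0<l₂y = subst (_< l₂ * fromℕ y) (ℚP.*-zeroʳ l₂)
      (ℚP.*-monoʳ-<-pos l₂ {{ℚ.positive 0<l₂}} (fromℕ-mono-< 0<y))

  weighted-suc-diff : ∀ x y → weighted x (suc y) - weighted x y ≡ l₂
  weighted-suc-diff x y = begin
    weighted x (suc y) - weighted x y
      ≡⟨ cong (λ c → (l₁ * fromℕ x + l₂ * c) - weighted x y) (fromℕ-+ 1 y) ⟩
    (l₁ * fromℕ x + l₂ * (1ℚ + fromℕ y)) - (l₁ * fromℕ x + l₂ * fromℕ y)
      ≡⟨ solve 4 (λ a p b q → (a :* p :+ b :* (con 1ℚ :+ q)) :- (a :* p :+ b :* q) := b)
               refl l₁ (fromℕ x) l₂ (fromℕ y) ⟩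
    l₂ ∎
    where open ≡-Reasoning

  l₂<weighted-1-1 : l₂ < weighted 1 1
  l₂<weighted-1-1 = subst₂ _<_ (ℚP.+-identityˡ l₂)
    (cong₂ _+_ (sym (ℚP.*-identityʳ l₁)) (sym (ℚP.*-identityʳ l₂))) (ℚP.+-monoˡ-< l₂ 0<l₁)

  combine-flat-zeroSpace : NoLoops M₂ → IsFlat r zeroSpace
  combine-flat-zeroSpace loopless₂ v dim-v _ =
    subst (_< r (zeroSpace ⊕ v)) (sym r0≡0) (weighted-pos (ρ M₁ (zeroSpace ⊕ v)) 0<ρ₂[0⊕v])
    where
    r0≡0 : r zeroSpace ≡ 0ℚ
    r0≡0 = trans (cong₂ weighted (ρ-zeroSpace M₁) (ρ-zeroSpace M₂)) weighted-zero
    0<ρ₂[0⊕v] : 0 ℕ.< ρ M₂ (zeroSpace ⊕ v)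
    0<ρ₂[0⊕v] = ℕP.≤-trans (ℕP.≤-reflexive (sym (noLoops⇒ρ-oneDim≡1 M₂ loopless₂ dim-v)))
                           (monotone M₂ v (zeroSpace ⊕ v) (⊕-inr zeroSpace v))

  combine-cyclic : NoLoops M₁ → NoLoops M₂ → ∀ {X} → IsCyclic (ρℚ M₁) X → IsCyclic r X
  combine-cyclic loopless₁ loopless₂ {X} cyclic₁ H codim with ρ M₂ X ℕ.≟ ρ M₂ H
  ... | yes ρ₂X≡ρ₂H = inj₁ (cong₂ weighted (cyclic⇒ρ-codim1-constant M₁ cyclic₁ codim) ρ₂X≡ρ₂H)
  ... | no ρ₂X≢ρ₂H with codim1-rank-step M₂ codim ρ₂X≢ρ₂H
  ...   | ρ₂X≡suc , a , dim-a , a⊆X , a⊈H =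
    inj₂ (subst (0ℚ <_) (sym Δ≡l₂) 0<l₂ , a , dim-a , a⊆X , a⊈H ,
          subst₂ _<_ (sym Δ≡l₂) (sym ra≡weighted-1-1) l₂<weighted-1-1)
    where
    Δ≡l₂ : r X - r H ≡ l₂
    Δ≡l₂ = trans
      (cong₂ (λ x y → weighted x y - r H) (cyclic⇒ρ-codim1-constant M₁ cyclic₁ codim) ρ₂X≡suc)
      (weighted-suc-diff (ρ M₁ H) (ρ M₂ H))
    ra≡weighted-1-1 : r a ≡ weighted 1 1
    ra≡weighted-1-1 = cong₂ weighted (noLoops⇒ρ-oneDim≡1 M₁ loopless₁ dim-a)
                           (noLoops⇒ρ-oneDim≡1 M₂ loopless₂ dim-a)

proposition4p11 : (F : FiniteField) (n : ℕ) (M₁ M₂ : Space.QMatroid F n) →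
    Space.FullQM F n M₁ → Space.NoLoops F n M₂ →
    (l₁ l₂ : ℚ) → 0ℚ < l₁ → 0ℚ < l₂ → l₁ + l₂ ≡ 1ℚ →
    Space.Full F n (Space.combine F n l₁ M₁ l₂ M₂)
proposition4p11 F n M₁ M₂ (flat₁ , cyclic₁) loopless₂ l₁ l₂ 0<l₁ 0<l₂ _ =
  combine-flat-zeroSpace loopless₂ , combine-cyclic loopless₁ loopless₂ cyclic₁
  where
  open Combination F n M₁ M₂ l₁ l₂ 0<l₁ 0<l₂
  loopless₁ : Space.NoLoops F n M₁
  loopless₁ = IntegralRank.flat-zeroSpace⇒noLoops F n M₁ flat₁
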